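{- Let $R$ be a finite ring, $\Delta$ the independence complex of $\Gamma(R)$, and $d=\dim\Delta$. If $J(R)\neq 0$, then the pure $d$-skeleton $\Delta^{[d]}$ is not connected in codimension 1.
   Context: Rings are finite, associative, with nonzero identity; $J(R)$ is the Jacobson radical. The unitary Cayley graph $\Gamma(R)$ has vertex set $R$, with distinct $x,y$ adjacent iff $x-y$ is a unit. The independence complex of a graph is the simplicial complex of its independent sets; the dimension of a face $A$ is $|A|-1$ and $\dim\Delta$ is the maximal face dimension. $\Delta^{[d]}$ is the simplicial complex whose facets are exactly the $d$-dimensional faces of $\Delta$. A pure simplicial complex is connected in codimension 1 if for any two facets $F,G$ there is a sequence of facets $F=F_0,\dots,F_t=G$ with $|F_{i-1}\cap F_i|=|F_i|-1$ for all $i$. -}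

module Defs where

open import Level using (0ℓ)
open import Data.Nat using (ℕ; suc; _≤_; _∸_)
open import Data.Fin using (Fin)
open import Data.Fin.Subset using (Subset; _∈_; _∩_; _⊆_; _⊂_; ∣_∣)
open import Data.Product using (Σ; ∃; _×_)
open import Relation.Binary.PropositionalEquality using (_≡_; _≢_)
open import Relation.Nullary using (¬_)
open import Algebra.Core using (Op₁; Op₂)
open import Algebra.Structures using (IsRing)

-- A finite ring (associative, with identity 1 ≠ 0).  Every finite ring is
-- isomorphic to one whose underlying set is Fin n, so we take the carrier
-- to be Fin n with propositional equality.
record FiniteRing : Set₁ where
  field
    n    : ℕ
    _+_  : Op₂ (Fin n)
    _*_  : Op₂ (Fin n)
    -_   : Op₁ (Fin n)
    0#   : Fin n
    1#   : Fin n
    isRing     : IsRing {A = Fin n} _≡_ _+_ _*_ -_ 0# 1#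
    nontrivial : 0# ≢ 1#

  infixl 6 _+_
  infixl 7 _*_

  Carrier : Set
  Carrier = Fin n

  _-_ : Op₂ Carrier
  x - y = x + (- y)

  IsUnit : Carrier → Set
  IsUnit x = ∃ λ y → (x * y ≡ 1#) × (y * x ≡ 1#)

  -- adjacency in the unitary Cayley graph Γ(R)
  Adjacent : Carrier → Carrier → Set
  Adjacent x y = (x ≢ y) × IsUnit (x - y)

  -- faces of the independence complex Δ of Γ(R)
  Independent : Subset n → Set
  Independent A = ∀ x y → x ∈ A → y ∈ A → ¬ Adjacent x y

  IsDim : ℕ → Set
  IsDim d = (∃ λ A → Independent A × ∣ A ∣ ≡ suc d)
          × (∀ A → Independent A → ∣ A ∣ ≤ suc d)

  -- facets of the pure skeleton Δ^[d] : the d-dimensional faces of Δ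
  IsFacet : ℕ → Subset n → Set
  IsFacet d A = Independent A × ∣ A ∣ ≡ suc d

  data Chain (d : ℕ) : Subset n → Subset n → Set where
    done : ∀ {F} → Chain d F F
    step : ∀ {F H G} → IsFacet d H → ∣ F ∩ H ∣ ≡ ∣ H ∣ ∸ 1 →
           Chain d H G → Chain d F G

  ConnectedInCodim1 : ℕ → Set
  ConnectedInCodim1 d = ∀ F G → IsFacet d F → IsFacet d G → Chain d F G

  IsLeftIdeal : Subset n → Set
  IsLeftIdeal I = (0# ∈ I)
                × (∀ a b → a ∈ I → b ∈ I → (a + b) ∈ I)
                × (∀ a → a ∈ I → (- a) ∈ I)
                × (∀ r a → a ∈ I → (r * a) ∈ I)

  IsMaximalLeftIdeal : Subset n → Set
  IsMaximalLeftIdeal M = IsLeftIdeal M × (¬ (1# ∈ M))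
                       × (∀ I → IsLeftIdeal I → M ⊂ I → 1# ∈ I)

  InJacobson : Carrier → Set
  InJacobson x = ∀ M → IsMaximalLeftIdeal M → x ∈ M

  JacobsonNonzero : Set
  JacobsonNonzero = ∃ λ x → InJacobson x × x ≢ 0#

{-# OPTIONS --safe #-}
-- For k ∈ J(R) and a unit u, u + k is again a unit, so adjacency in Γ(R) is unchanged when
-- either endpoint is moved by an element of J(R).  A facet F of Δ^[d] is an independent set of
-- maximum size, so it is closed under x ↦ x + k for k ∈ J(R).  If J(R) ∋ j ≠ 0, a point x of
-- F ∖ H for another facet H brings x + j ∈ F ∖ H along, so |F ∩ H| < d and no codimension-one
-- step between distinct facets exists.  But there are two distinct facets: F misses 0 or 1
-- (they are adjacent), and a translate of F is a facet containing the missing vertex.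
module Submission where

open import Defs
open import Data.Nat using (ℕ)
open import Relation.Nullary using (¬_)

open import Level using (0ℓ)
open import Data.Nat using (suc; _≤_; _<_; _∸_; z≤n; s≤s)
import Data.Nat.Properties as ℕ
open import Data.Bool using (true; false)
open import Data.Fin using (Fin; zero; suc)
open import Data.Fin.Properties using (any?; ¬∀⟶∃¬) renaming (_≟_ to _≟ᶠ_)
open import Data.Fin.Subset hiding (_-_)
open import Data.Fin.Subset.Properties
open import Data.Fin.Subset.Induction using (⊂-wellFounded; ⊃-wellFounded)
open import Data.Vec using (_∷_; here; there; tabulate)
open import Data.Vec.Properties using (lookup∘tabulate; []=⇒lookup; lookup⇒[]=)
open import Data.Product using (∃; _×_; _,_; proj₁; proj₂)
open import Data.Sum using (inj₁; inj₂)
open import Function using (_∘_)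
open import Function.Definitions using (Injective)
open import Induction.WellFounded using (Acc; acc)
open import Relation.Nullary using (yes; no; does; contradiction; ¬?)
open import Relation.Nullary.Decidable using (dec-true; dec-false; decidable-stable; _×-dec_)
open import Relation.Unary using (Decidable)
open import Relation.Binary.PropositionalEquality
open import Algebra.Bundles using (Ring)
open import Algebra.Structures using (IsRing)
import Algebra.Properties.Ring as RingProperties
import Algebra.Properties.CommutativeSemigroup as CommutativeSemigroupProperties

module _ {n : ℕ} where

  fromDecidable : {P : Fin n → Set} → Decidable P → Subset n
  fromDecidable P? = tabulate (λ z → does (P? z))

  module _ {P : Fin n → Set} (P? : Decidable P) {z : Fin n} where

    ∈-fromDecidable⁺ : P z → z ∈ fromDecidable P?
    ∈-fromDecidable⁺ pz =
      lookup⇒[]= z _ (trans (lookup∘tabulate _ z) (dec-true (P? z) pz))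

    ∈-fromDecidable⁻ : z ∈ fromDecidable P? → P z
    ∈-fromDecidable⁻ z∈ = decidable-stable (P? z) λ ¬pz → true≢false
      (trans (sym ([]=⇒lookup z∈)) (trans (lookup∘tabulate _ z) (dec-false (P? z) ¬pz)))
      where
      true≢false : ¬ true ≡ false
      true≢false ()

  Empty⇒∣p∣≡0 : ∀ {p : Subset n} → Empty p → ∣ p ∣ ≡ 0
  Empty⇒∣p∣≡0 p-empty = trans (cong ∣_∣ (Empty-unique p-empty)) (∣⊥∣≡0 n)

  ∣p∣≡1+k⇒Nonempty : ∀ {p : Subset n} {k} → ∣ p ∣ ≡ suc k → Nonempty p
  ∣p∣≡1+k⇒Nonempty {p} ∣p∣≡1+k with nonempty? p
  ... | yes p-nonempty = p-nonempty
  ... | no  p-empty    = contradiction (trans (sym (Empty⇒∣p∣≡0 p-empty)) ∣p∣≡1+k) ℕ.0≢1+n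

  ∣p∩q∣<∣p∣⇒∃∈p∖q : ∀ {p q : Subset n} → ∣ p ∩ q ∣ < ∣ p ∣ → ∃ λ x → x ∈ p × x ∉ q
  ∣p∩q∣<∣p∣⇒∃∈p∖q {p} {q} ∣p∩q∣<∣p∣ with any? (λ x → x ∈? p ×-dec ¬? (x ∈? q))
  ... | yes found = found
  ... | no ¬found = contradiction (p⊆q⇒∣p∣≤∣q∣ p⊆p∩q) (ℕ.<⇒≱ ∣p∩q∣<∣p∣)
    where
    p⊆p∩q : p ⊆ p ∩ q
    p⊆p∩q {x} x∈p = x∈p∩q⁺ (x∈p , decidable-stable (x ∈? q) (λ x∉q → ¬found (x , x∈p , x∉q)))

x∉p─⁅x⁆ : ∀ {n} (p : Subset n) x → x ∉ p ─ ⁅ x ⁆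
x∉p─⁅x⁆ (_ ∷ p) zero    ()
x∉p─⁅x⁆ (_ ∷ p) (suc x) (there x∈p─x) = x∉p─⁅x⁆ p x x∈p─x

x∈p⇒∣p∣≡1+∣p─⁅x⁆∣ : ∀ {n} {p : Subset n} {x} → x ∈ p → ∣ p ∣ ≡ suc ∣ p ─ ⁅ x ⁆ ∣
x∈p⇒∣p∣≡1+∣p─⁅x⁆∣ {p = _ ∷ p}         here        = cong suc (cong ∣_∣ (sym (p─⊥≡p p)))
x∈p⇒∣p∣≡1+∣p─⁅x⁆∣ {p = inside  ∷ _} (there x∈p) = cong suc (x∈p⇒∣p∣≡1+∣p─⁅x⁆∣ x∈p)
x∈p⇒∣p∣≡1+∣p─⁅x⁆∣ {p = outside ∷ _} (there x∈p) = x∈p⇒∣p∣≡1+∣p─⁅x⁆∣ x∈p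

module _ {m n : ℕ} (f : Fin m → Fin n) (f-injective : Injective _≡_ _≡_ f) where

  injection⇒∣p∣≤∣q∣ : ∀ {p q} → (∀ {x} → x ∈ p → f x ∈ q) → ∣ p ∣ ≤ ∣ q ∣
  injection⇒∣p∣≤∣q∣ {p} = go p (⊂-wellFounded p)
    where
    go : ∀ p → Acc _⊂_ p → ∀ {q} → (∀ {x} → x ∈ p → f x ∈ q) → ∣ p ∣ ≤ ∣ q ∣
    go p (acc rec) {q} maps with nonempty? p
    ... | no  p-empty = subst (_≤ ∣ q ∣) (sym (Empty⇒∣p∣≡0 p-empty)) z≤n
    ... | yes (x , x∈p) = begin
      ∣ p ∣                ≡⟨ x∈p⇒∣p∣≡1+∣p─⁅x⁆∣ x∈p ⟩
      suc ∣ p ─ ⁅ x ⁆ ∣    ≤⟨ s≤s (go (p ─ ⁅ x ⁆) (rec (x∈p⇒p-x⊂p x∈p)) maps-x) ⟩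
      suc ∣ q ─ ⁅ f x ⁆ ∣  ≡⟨ x∈p⇒∣p∣≡1+∣p─⁅x⁆∣ (maps x∈p) ⟨
      ∣ q ∣                ∎
      where
      open ℕ.≤-Reasoning
      maps-x : ∀ {y} → y ∈ p ─ ⁅ x ⁆ → f y ∈ q ─ ⁅ f x ⁆
      maps-x y∈p─x = x∈p∧x≢y⇒x∈p-y (maps (p─q⊆p p ⁅ x ⁆ y∈p─x))
        (λ fy≡fx → x∉p─⁅x⁆ p x (subst (_∈ p ─ ⁅ x ⁆) (f-injective fy≡fx) y∈p─x))

module FiniteRingProperties (R : FiniteRing) where
  open FiniteRing R
  open IsRing isRing using
    (+-assoc; +-identityʳ; -‿inverseʳ; *-assoc; *-identityˡ; *-identityʳ;
     distribˡ; distribʳ; zeroˡ)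
  open ≡-Reasoning

  ring : Ring 0ℓ 0ℓ
  ring = record
    { Carrier = Carrier ; _≈_ = _≡_ ; _+_ = _+_ ; _*_ = _*_ ; -_ = -_
    ; 0# = 0# ; 1# = 1# ; isRing = isRing }

  open RingProperties ring using
    (-0#≈0#; -‿distribˡ-*; -‿+-comm; ⁻¹-anti-homo‿-; xyx⁻¹≈y;
     //-rightDividesˡ; //-rightDividesʳ; x≈z//y; +-cancelʳ; +-identityʳ-unique)
  open CommutativeSemigroupProperties (Ring.+-commutativeSemigroup ring) using (xy∙z≈xz∙y)

  [x+k]-y≡[x-y]+k : ∀ x k y → (x + k) - y ≡ (x - y) + k
  [x+k]-y≡[x-y]+k x k y = xy∙z≈xz∙y x k (- y)

  x-[y+k]≡[x-y]-k : ∀ x y k → x - (y + k) ≡ (x - y) - k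
  x-[y+k]≡[x-y]-k x y k = begin
    x + - (y + k)     ≡⟨ cong (x +_) (-‿+-comm y k) ⟨
    x + (- y + - k)   ≡⟨ +-assoc x (- y) (- k) ⟨
    (x - y) - k       ∎

  [x-r]-[y-r]≡x-y : ∀ x y r → (x - r) - (y - r) ≡ x - y
  [x-r]-[y-r]≡x-y x y r = begin
    (x - r) + - (y - r)  ≡⟨ cong ((x - r) +_) (⁻¹-anti-homo‿- y r) ⟩
    (x - r) + (r - y)    ≡⟨ +-assoc (x - r) r (- y) ⟨
    ((x - r) + r) - y    ≡⟨ cong (_- y) (//-rightDividesˡ r x) ⟩
    x - y                ∎

  y-[y-x]≡x : ∀ x y → y - (y - x) ≡ x
  y-[y-x]≡x x y = begin
    y + - (y - x)   ≡⟨ cong (y +_) (⁻¹-anti-homo‿- y x) ⟩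
    y + (x - y)     ≡⟨ +-assoc y x (- y) ⟨
    (y + x) - y     ≡⟨ xyx⁻¹≈y y x ⟩
    x               ∎

  IsUnit-1# : IsUnit 1#
  IsUnit-1# = 1# , *-identityˡ 1# , *-identityˡ 1#

  ¬IsUnit-0# : ¬ IsUnit 0#
  ¬IsUnit-0# (v , 0v≡1 , _) = nontrivial (trans (sym (zeroˡ v)) 0v≡1)

  IsUnit-* : ∀ {u v} → IsUnit u → IsUnit v → IsUnit (u * v)
  IsUnit-* {u} {v} (u⁻¹ , uu⁻¹≡1 , u⁻¹u≡1) (v⁻¹ , vv⁻¹≡1 , v⁻¹v≡1) =
    v⁻¹ * u⁻¹ , cancel u v v⁻¹ u⁻¹ vv⁻¹≡1 uu⁻¹≡1 , cancel v⁻¹ u⁻¹ u v u⁻¹u≡1 v⁻¹v≡1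
    where
    cancel : ∀ a b c d → b * c ≡ 1# → a * d ≡ 1# → (a * b) * (c * d) ≡ 1#
    cancel a b c d bc≡1 ad≡1 = begin
      (a * b) * (c * d)  ≡⟨ *-assoc a b (c * d) ⟩
      a * (b * (c * d))  ≡⟨ cong (a *_) (*-assoc b c d) ⟨
      a * ((b * c) * d)  ≡⟨ cong (λ w → a * (w * d)) bc≡1 ⟩
      a * (1# * d)       ≡⟨ cong (a *_) (*-identityˡ d) ⟩
      a * d              ≡⟨ ad≡1 ⟩
      1#                 ∎

  leftInverse≡rightInverse : ∀ {a b c} → b * a ≡ 1# → a * c ≡ 1# → b ≡ c
  leftInverse≡rightInverse {a} {b} {c} ba≡1 ac≡1 = begin
    b              ≡⟨ *-identityʳ b ⟨
    b * 1#         ≡⟨ cong (b *_) ac≡1 ⟨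
    b * (a * c)    ≡⟨ *-assoc b a c ⟨
    (b * a) * c    ≡⟨ cong (_* c) ba≡1 ⟩
    1# * c         ≡⟨ *-identityˡ c ⟩
    c              ∎

  IsUnit⇒Adjacent : ∀ {x y} → IsUnit (x - y) → Adjacent x y
  IsUnit⇒Adjacent {x} u = (λ { refl → ¬IsUnit-0# (subst IsUnit (-‿inverseʳ x) u) }) , u

  Adjacent-1#-0# : Adjacent 1# 0#
  Adjacent-1#-0# = IsUnit⇒Adjacent (subst IsUnit 1≡1-0 IsUnit-1#)
    where
    1≡1-0 : 1# ≡ 1# - 0#
    1≡1-0 = sym (trans (cong (1# +_) -0#≈0#) (+-identityʳ 1#))

  InJacobson-*ˡ : ∀ r {k} → InJacobson k → InJacobson (r * k)
  InJacobson-*ˡ r k∈J M M-max@((_ , _ , _ , *-closed) , _) = *-closed r _ (k∈J M M-max)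

  InJacobson-neg : ∀ {k} → InJacobson k → InJacobson (- k)
  InJacobson-neg k∈J M M-max@((_ , _ , neg-closed , _) , _) = neg-closed _ (k∈J M M-max)

  -- Zorn's lemma for a finite ring, in double-negated form: maximality is not decided here.
  proper⇒⊆maximal : ∀ {I} → IsLeftIdeal I → 1# ∉ I →
                    ¬ (∀ M → IsMaximalLeftIdeal M → ¬ I ⊆ M)
  proper⇒⊆maximal {I} = go I (⊃-wellFounded I)
    where
    go : ∀ I → Acc _⊃_ I → IsLeftIdeal I → 1# ∉ I → ¬ (∀ M → IsMaximalLeftIdeal M → ¬ I ⊆ M)
    go I (acc rec) I-ideal 1∉I noMaximal = noMaximal I (I-ideal , 1∉I , I-maximal) (λ x∈I → x∈I)
      where
      I-maximal : ∀ I′ → IsLeftIdeal I′ → I ⊂ I′ → 1# ∈ I′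
      I-maximal I′ I′-ideal I⊂I′ = decidable-stable (1# ∈? I′) λ 1∉I′ →
        go I′ (rec I⊂I′) I′-ideal 1∉I′ λ M M-max I′⊆M →
          noMaximal M M-max (⊆-trans (p⊂q⇒p⊆q I⊂I′) I′⊆M)

  leftMultiples : Carrier → Subset n
  leftMultiples c = fromDecidable (λ a → any? (λ r → r * c ≟ᶠ a))

  ∈-leftMultiples⁺ : ∀ {c a} → ∃ (λ r → r * c ≡ a) → a ∈ leftMultiples c
  ∈-leftMultiples⁺ {c} = ∈-fromDecidable⁺ (λ a → any? (λ r → r * c ≟ᶠ a))

  ∈-leftMultiples⁻ : ∀ {c a} → a ∈ leftMultiples c → ∃ (λ r → r * c ≡ a)
  ∈-leftMultiples⁻ {c} = ∈-fromDecidable⁻ (λ a → any? (λ r → r * c ≟ᶠ a))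

  leftMultiples-isLeftIdeal : ∀ c → IsLeftIdeal (leftMultiples c)
  leftMultiples-isLeftIdeal c =
      ∈-leftMultiples⁺ (0# , zeroˡ c)
    , (λ a b a∈Rc b∈Rc → +-closed (∈-leftMultiples⁻ a∈Rc) (∈-leftMultiples⁻ b∈Rc))
    , (λ a a∈Rc → neg-closed (∈-leftMultiples⁻ a∈Rc))
    , (λ t a a∈Rc → *-closed t (∈-leftMultiples⁻ a∈Rc))
    where
    +-closed : ∀ {a b} → ∃ (λ r → r * c ≡ a) → ∃ (λ r → r * c ≡ b) → a + b ∈ leftMultiples c
    +-closed (r , refl) (s , refl) = ∈-leftMultiples⁺ (r + s , distribʳ c r s)
    neg-closed : ∀ {a} → ∃ (λ r → r * c ≡ a) → - a ∈ leftMultiples c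
    neg-closed (r , refl) = ∈-leftMultiples⁺ (- r , sym (-‿distribˡ-* r c))
    *-closed : ∀ t {a} → ∃ (λ r → r * c ≡ a) → t * a ∈ leftMultiples c
    *-closed t (r , refl) = ∈-leftMultiples⁺ (t * r , *-assoc t r c)

  1+J⇒leftInvertible : ∀ {k} → InJacobson k → ∃ λ a → a * (1# + k) ≡ 1#
  1+J⇒leftInvertible {k} k∈J with any? (λ a → a * (1# + k) ≟ᶠ 1#)
  ... | yes found = found
  ... | no ¬found =
    contradiction Rc⊈M (proper⇒⊆maximal (leftMultiples-isLeftIdeal c) (¬found ∘ ∈-leftMultiples⁻))
    where
    c : Carrier
    c = 1# + k
    -- k lies in every maximal M, so c ∈ M would force 1 = c - k ∈ M.
    Rc⊈M : ∀ M → IsMaximalLeftIdeal M → ¬ leftMultiples c ⊆ M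
    Rc⊈M M M-max@((_ , +-closed , neg-closed , _) , 1∉M , _) Rc⊆M =
      1∉M (subst (_∈ M) (//-rightDividesʳ k 1#)
        (+-closed c (- k) (Rc⊆M (∈-leftMultiples⁺ (1# , *-identityˡ c)))
                          (neg-closed k (k∈J M M-max))))

  1+J⇒IsUnit : ∀ {k} → InJacobson k → IsUnit (1# + k)
  1+J⇒IsUnit {k} k∈J with 1+J⇒leftInvertible k∈J
  ... | a , a[1+k]≡1 with 1+J⇒leftInvertible (InJacobson-neg (InJacobson-*ˡ a k∈J))
  ... | b , b[1-ak]≡1 =
    a , subst (λ b′ → b′ * a ≡ 1#) (leftInverse≡rightInverse ba≡1 a[1+k]≡1) ba≡1 , a[1+k]≡1
    where
    -- a = 1 - a k is itself of the form 1 + J, so it has a left inverse b, which must be 1 + k.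
    a≡1-ak : a ≡ 1# - (a * k)
    a≡1-ak = x≈z//y a (a * k) 1# (begin
      a + a * k         ≡⟨ cong (_+ a * k) (*-identityʳ a) ⟨
      a * 1# + a * k    ≡⟨ distribˡ a 1# k ⟨
      a * (1# + k)      ≡⟨ a[1+k]≡1 ⟩
      1#                ∎)
    ba≡1 : b * a ≡ 1#
    ba≡1 = trans (cong (b *_) a≡1-ak) b[1-ak]≡1

  IsUnit-+J : ∀ {u k} → IsUnit u → InJacobson k → IsUnit (u + k)
  IsUnit-+J {u} {k} u-unit@(v , uv≡1 , _) k∈J =
    subst IsUnit u[1+vk]≡u+k (IsUnit-* u-unit (1+J⇒IsUnit (InJacobson-*ˡ v k∈J)))
    where
    u[1+vk]≡u+k : u * (1# + v * k) ≡ u + k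
    u[1+vk]≡u+k = begin
      u * (1# + v * k)       ≡⟨ distribˡ u 1# (v * k) ⟩
      u * 1# + u * (v * k)   ≡⟨ cong₂ _+_ (*-identityʳ u) (sym (*-assoc u v k)) ⟩
      u + (u * v) * k        ≡⟨ cong (λ w → u + w * k) uv≡1 ⟩
      u + 1# * k             ≡⟨ cong (u +_) (*-identityˡ k) ⟩
      u + k                  ∎

  IsUnit-+J⁻ : ∀ {u k} → InJacobson k → IsUnit (u + k) → IsUnit u
  IsUnit-+J⁻ {u} {k} k∈J u+k-unit =
    subst IsUnit (//-rightDividesʳ k u) (IsUnit-+J u+k-unit (InJacobson-neg k∈J))

  Adjacent-+Jˡ : ∀ {x y k} → InJacobson k → Adjacent (x + k) y → Adjacent x y
  Adjacent-+Jˡ {x} {y} {k} k∈J (_ , u) =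
    IsUnit⇒Adjacent (IsUnit-+J⁻ k∈J (subst IsUnit ([x+k]-y≡[x-y]+k x k y) u))

  Adjacent-+Jʳ : ∀ {x y k} → InJacobson k → Adjacent x (y + k) → Adjacent x y
  Adjacent-+Jʳ {x} {y} {k} k∈J (_ , u) =
    IsUnit⇒Adjacent (IsUnit-+J⁻ (InJacobson-neg k∈J) (subst IsUnit (x-[y+k]≡[x-y]-k x y k) u))

  _+ˢ_ : Subset n → Carrier → Subset n
  A +ˢ r = fromDecidable (λ z → z - r ∈? A)

  ∈-+ˢ⁺ : ∀ {A r z} → z - r ∈ A → z ∈ A +ˢ r
  ∈-+ˢ⁺ {A} {r} = ∈-fromDecidable⁺ (λ z → z - r ∈? A)

  ∈-+ˢ⁻ : ∀ {A r z} → z ∈ A +ˢ r → z - r ∈ A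
  ∈-+ˢ⁻ {A} {r} = ∈-fromDecidable⁻ (λ z → z - r ∈? A)

  ∣A+ˢr∣≡∣A∣ : ∀ A r → ∣ A +ˢ r ∣ ≡ ∣ A ∣
  ∣A+ˢr∣≡∣A∣ A r = ℕ.≤-antisym
    (injection⇒∣p∣≤∣q∣ (_- r) (+-cancelʳ (- r) _ _) ∈-+ˢ⁻)
    (injection⇒∣p∣≤∣q∣ (_+ r) (+-cancelʳ r _ _)
      (λ {z} z∈A → ∈-+ˢ⁺ (subst (_∈ A) (sym (//-rightDividesʳ r z)) z∈A)))

  Independent-+ˢ : ∀ {A} r → Independent A → Independent (A +ˢ r)
  Independent-+ˢ r A-indep a b a∈ b∈ (_ , a-b-unit) =
    A-indep (a - r) (b - r) (∈-+ˢ⁻ a∈) (∈-+ˢ⁻ b∈)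
      (IsUnit⇒Adjacent (subst IsUnit (sym ([x-r]-[y-r]≡x-y a b r)) a-b-unit))

  another-facet : ∀ {d F} → IsFacet d F → ∃ λ G → IsFacet d G × G ≢ F
  another-facet {d} {F} (F-indep , ∣F∣≡1+d)
    with ∣p∣≡1+k⇒Nonempty ∣F∣≡1+d
       | ¬∀⟶∃¬ n (_∈ F) (_∈? F) (λ ⊤⊆F → F-indep 1# 0# (⊤⊆F 1#) (⊤⊆F 0#) Adjacent-1#-0#)
  ... | x , x∈F | y , y∉F =
    G , (Independent-+ˢ (y - x) F-indep , trans (∣A+ˢr∣≡∣A∣ F (y - x)) ∣F∣≡1+d) ,
    λ G≡F → y∉F (subst (y ∈_) G≡F y∈G)
    where
    G : Subset n
    G = F +ˢ (y - x)
    y∈G : y ∈ G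
    y∈G = ∈-+ˢ⁺ (subst (_∈ F) (sym (y-[y-x]≡x x y)) x∈F)

  Independent-∪⁅⁆ : ∀ {A e} → Independent A →
                    (∀ a → a ∈ A → ¬ Adjacent a e) → (∀ a → a ∈ A → ¬ Adjacent e a) →
                    Independent (A ∪ ⁅ e ⁆)
  Independent-∪⁅⁆ {A} {e} A-indep ≁e e≁ a b a∈ b∈ a~b
    with x∈p∪q⁻ A ⁅ e ⁆ a∈ | x∈p∪q⁻ A ⁅ e ⁆ b∈
  ... | inj₁ a∈A | inj₁ b∈A = A-indep a b a∈A b∈A a~b
  ... | inj₁ a∈A | inj₂ b∈e = ≁e a a∈A (subst (Adjacent a) (x∈⁅y⁆⇒x≡y e b∈e) a~b)
  ... | inj₂ a∈e | inj₁ b∈A = e≁ b b∈A (subst (λ w → Adjacent w b) (x∈⁅y⁆⇒x≡y e a∈e) a~b)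
  ... | inj₂ a∈e | inj₂ b∈e = proj₁ a~b (trans (x∈⁅y⁆⇒x≡y e a∈e) (sym (x∈⁅y⁆⇒x≡y e b∈e)))

  module Facets {d : ℕ} (maximum : ∀ A → Independent A → ∣ A ∣ ≤ suc d) where

    facet-+J : ∀ {F k x} → IsFacet d F → InJacobson k → x ∈ F → x + k ∈ F
    facet-+J {F} {k} {x} (F-indep , ∣F∣≡1+d) k∈J x∈F =
      decidable-stable (x + k ∈? F) λ x+k∉F →
        ℕ.<⇒≱ (larger x+k∉F) (maximum (F ∪ ⁅ x + k ⁆) (Independent-∪⁅⁆ F-indep ≁x+k x+k≁))
      where
      ≁x+k : ∀ a → a ∈ F → ¬ Adjacent a (x + k)
      ≁x+k a a∈F a~x+k = F-indep a x a∈F x∈F (Adjacent-+Jʳ k∈J a~x+k)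
      x+k≁ : ∀ a → a ∈ F → ¬ Adjacent (x + k) a
      x+k≁ a a∈F x+k~a = F-indep x a x∈F a∈F (Adjacent-+Jˡ k∈J x+k~a)
      larger : x + k ∉ F → suc d < ∣ F ∪ ⁅ x + k ⁆ ∣
      larger x+k∉F = subst (_< ∣ F ∪ ⁅ x + k ⁆ ∣) ∣F∣≡1+d (p⊂q⇒∣p∣<∣q∣
        (p⊆p∪q ⁅ x + k ⁆ , x + k , x∈p∪q⁺ (inj₂ (x∈⁅x⁆ (x + k))) , x+k∉F))

    ∣facet∩facet∣<d : ∀ {j F H} → InJacobson j → j ≢ 0# → IsFacet d F → IsFacet d H →
                      (∃ λ x → x ∈ F × x ∉ H) → ∣ F ∩ H ∣ < d
    ∣facet∩facet∣<d {j} {F} {H} j∈J j≢0 F-facet@(_ , ∣F∣≡1+d) H-facet (x , x∈F , x∉H) =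
      subst (∣ F ∩ H ∣ <_) ∣F─x∣≡d (p⊂q⇒∣p∣<∣q∣ F∩H⊂F─x)
      where
      x+j∈F : x + j ∈ F
      x+j∈F = facet-+J F-facet j∈J x∈F
      x+j∉H : x + j ∉ H
      x+j∉H x+j∈H =
        x∉H (subst (_∈ H) (//-rightDividesʳ j x) (facet-+J H-facet (InJacobson-neg j∈J) x+j∈H))
      x+j≢x : x + j ≢ x
      x+j≢x x+j≡x = j≢0 (+-identityʳ-unique x j x+j≡x)
      F∩H⊂F─x : F ∩ H ⊂ F ─ ⁅ x ⁆
      F∩H⊂F─x = (λ z∈F∩H → x∈p∧x≢y⇒x∈p-y (proj₁ (x∈p∩q⁻ F H z∈F∩H))
                               (λ { refl → x∉H (proj₂ (x∈p∩q⁻ F H z∈F∩H)) }))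
              , x + j , x∈p∧x≢y⇒x∈p-y x+j∈F x+j≢x
              , (λ x+j∈F∩H → x+j∉H (proj₂ (x∈p∩q⁻ F H x+j∈F∩H)))
      ∣F─x∣≡d : ∣ F ─ ⁅ x ⁆ ∣ ≡ d
      ∣F─x∣≡d = ℕ.suc-injective (trans (sym (x∈p⇒∣p∣≡1+∣p─⁅x⁆∣ x∈F)) ∣F∣≡1+d)

    facet∩facet≢d : ∀ {j F H} → InJacobson j → j ≢ 0# → IsFacet d F → IsFacet d H →
                    ∣ F ∩ H ∣ ≢ ∣ H ∣ ∸ 1
    facet∩facet≢d {j} {F} {H} j∈J j≢0 F-facet@(_ , ∣F∣≡1+d) H-facet@(_ , ∣H∣≡1+d) ∣F∩H∣≡∣H∣-1 =
      ℕ.<-irrefl ∣F∩H∣≡d (∣facet∩facet∣<d j∈J j≢0 F-facet H-facet (∣p∩q∣<∣p∣⇒∃∈p∖q ∣F∩H∣<∣F∣))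
      where
      ∣F∩H∣≡d : ∣ F ∩ H ∣ ≡ d
      ∣F∩H∣≡d = trans ∣F∩H∣≡∣H∣-1 (cong (_∸ 1) ∣H∣≡1+d)
      ∣F∩H∣<∣F∣ : ∣ F ∩ H ∣ < ∣ F ∣
      ∣F∩H∣<∣F∣ = subst₂ _<_ (sym ∣F∩H∣≡d) (sym ∣F∣≡1+d) (ℕ.n<1+n d)

    Chain⇒≡ : ∀ {j F G} → InJacobson j → j ≢ 0# → IsFacet d F → Chain d F G → F ≡ G
    Chain⇒≡ j∈J j≢0 F-facet done                      = refl
    Chain⇒≡ j∈J j≢0 F-facet (step H-facet ∣F∩H∣≡∣H∣-1 _) =
      contradiction ∣F∩H∣≡∣H∣-1 (facet∩facet≢d j∈J j≢0 F-facet H-facet)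

lemma3p8 : (R : FiniteRing) (d : ℕ) → FiniteRing.IsDim R d →
    FiniteRing.JacobsonNonzero R → ¬ FiniteRing.ConnectedInCodim1 R d
lemma3p8 R d ((F , F-facet) , maximum) (j , j∈J , j≢0) connected =
  let G , G-facet , G≢F = another-facet F-facet
  in  G≢F (sym (Chain⇒≡ j∈J j≢0 F-facet (connected F G F-facet G-facet)))
  where
  open FiniteRingProperties R
  open Facets maximum
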